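{- Let $q$ be a prime power, $F=\mathrm{GF}(q)$, $m\ge 2$, $n=\frac{q^m-1}{q-1}$, and let $\mathfrak{A}$, $\mathcal H_m$, $\bar e^{(\delta)}$, $R_\delta$, $\bar\alpha$ be as in the context. Assume $\delta,\kappa\in F^m$ both have first entry equal to $1$ and the Hamming distance between $\delta$ and $\kappa$ is at least $3$. Then the sets $R_\delta+\bar\delta-\bar e^{(\delta)}$ and $R_\kappa+\bar\kappa-\bar e^{(\kappa)}$ are disjoint.
   Context: $\mathfrak{A}\subset F^m$ is the set of nonzero vectors whose first nonzero entry equals $1$ (so $|\mathfrak{A}|=n$). The coordinates of $F^n$ are indexed by $\mathfrak{A}$, the first $m$ coordinates being indexed by $\pi^{(1)}=(1,0,\ldots,0),\ldots,\pi^{(m)}=(0,\ldots,0,1)$ and the rest in some fixed order. The Hamming code is $\mathcal H_m=\{\bar c\in F^n\mid \sum_{\alpha\in\mathfrak{A}}c_\alpha\alpha=0^m\}$. For $\delta\in\mathfrak{A}$, $\bar e^{(\delta)}$ is the unit vector of $F^n$ with $1$ in coordinate $\delta$; $T_\delta$ is the set of $\bar c\in\mathcal H_m$ with exactly three nonzero coordinates and $c_\delta=1$; $R_\delta$ is the linear span of $T_\delta$. For $\alpha=(\alpha_1,\ldots,\alpha_m)\in F^m$, $\bar\alpha=(\alpha,0^{n-m})=\sum_{i=1}^m\alpha_i\bar e^{(\pi^{(i)})}\in F^n$. The Hamming distance between two vectors is the number of positions in which they differ. -}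

module Defs where

open import Level using (0ℓ)
open import Data.Nat using (ℕ; zero; suc) renaming (_+_ to _+ℕ_)
open import Data.Fin using (Fin) renaming (_≟_ to _≟F_)
open import Data.Fin.Base using (toℕ)
open import Data.Bool using (Bool; true; false; if_then_else_; _∧_; T)
open import Data.Unit using (⊤; tt)
open import Data.Empty using (⊥)
open import Data.List using (List; []; _∷_; map; concatMap; foldr; length; filter)
import Data.List as L
open import Data.Vec using (Vec; []; _∷_; replicate; zipWith)
open import Data.Vec.Properties using () renaming (≡-dec to ≡-decVec)
open import Data.Product using (Σ; ∃; _×_; _,_; proj₁; proj₂)
open import Relation.Nullary using (¬_; Dec; yes; no)
open import Relation.Nullary.Decidable using (⌊_⌋)
open import Relation.Binary.PropositionalEquality using (_≡_; _≢_)
open import Algebra.Structures using (IsCommutativeRing)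
open import Relation.Unary using (Pred)

-- A finite field with q elements, presented (up to isomorphism) on the
-- carrier Fin q with propositional equality.  Every finite field GF(q)
-- is isomorphic to such a structure, and q is then automatically a prime power.
record FiniteField (q : ℕ) : Set where
  infixl 7 _*_
  infixl 6 _+_
  field
    _+_ _*_ : Fin q → Fin q → Fin q
    -_      : Fin q → Fin q
    0# 1#   : Fin q
    isCommutativeRing : IsCommutativeRing _≡_ _+_ _*_ -_ 0# 1#
    0≢1     : 0# ≢ 1#
    inverse : ∀ x → x ≢ 0# → ∃ λ y → x * y ≡ 1#

module HammingDefs {q : ℕ} (𝔽 : FiniteField q) where
  open FiniteField 𝔽

  F : Set
  F = Fin q

  allVec : (m : ℕ) → List (Vec F m)
  allVec zero = [] ∷ []
  allVec (suc m) = concatMap (λ x → map (x ∷_) (allVec m)) (Data.List.tabulate {n = q} (λ i → i))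

  isNorm : {m : ℕ} → Vec F m → Bool
  isNorm [] = false
  isNorm (x ∷ v) = if ⌊ x ≟F 1# ⌋ then true else (⌊ x ≟F 0# ⌋ ∧ isNorm v)

  𝔄 : ℕ → Set
  𝔄 m = Σ (Vec F m) (λ v → T (isNorm v))

  -- vectors of F^n, coordinates indexed by 𝔄
  Word : ℕ → Set
  Word m = 𝔄 m → F

  -- coordinate of a word at an arbitrary v ∈ F^m (0 if v ∉ 𝔄)
  ext : (b : Bool) → (T b → F) → F
  ext true f = f tt
  ext false f = 0#

  coord : {m : ℕ} → Word m → Vec F m → F
  coord c v = ext (isNorm v) (λ p → c (v , p))

  _·v_ : {m : ℕ} → F → Vec F m → Vec F m
  a ·v v = Data.Vec.map (a *_) v

  _+v_ : {m : ℕ} → Vec F m → Vec F m → Vec F m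
  _+v_ = zipWith _+_

  syndrome : {m : ℕ} → Word m → Vec F m
  syndrome {m} c = foldr (λ v acc → (coord c v ·v v) +v acc) (replicate m 0#) (allVec m)

  InHamming : {m : ℕ} → Word m → Set
  InHamming {m} c = syndrome c ≡ replicate m 0#

  weight : {m : ℕ} → Word m → ℕ
  weight {m} c = length (filter (λ v → Relation.Nullary.¬? (coord c v ≟F 0#)) (allVec m))

  e : {m : ℕ} → 𝔄 m → Word m
  e δ α = if ⌊ ≡-decVec _≟F_ (proj₁ α) (proj₁ δ) ⌋ then 1# else 0#

  Tset : {m : ℕ} → 𝔄 m → Pred (Word m) 0ℓ
  Tset δ c = InHamming c × weight c ≡ 3 × c δ ≡ 1#

  0w : {m : ℕ} → Word m
  0w _ = 0#

  data Span {m : ℕ} (P : Pred (Word m) 0ℓ) : Pred (Word m) 0ℓ where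
    span-zero : Span P 0w
    span-step : (a : F) (y z : Word m) → P y → Span P z →
                Span P (λ α → a * y α + z α)

  R : {m : ℕ} → 𝔄 m → Pred (Word m) 0ℓ
  R δ = Span (Tset δ)

  -- ᾱ = (α, 0^{n-m}) : coordinate π^(i) gets α_i, all others get 0
  allZero : {m : ℕ} → Vec F m → Bool
  allZero [] = true
  allZero (x ∷ v) = ⌊ x ≟F 0# ⌋ ∧ allZero v

  barCoord : {m : ℕ} → Vec F m → Vec F m → F
  barCoord [] [] = 0#
  barCoord (a ∷ α) (x ∷ v) =
    if ⌊ x ≟F 1# ⌋ ∧ allZero v then a
    else (if ⌊ x ≟F 0# ⌋ then barCoord α v else 0#)

  bar : {m : ℕ} → Vec F m → Word m
  bar α β = barCoord α (proj₁ β)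

  _+S_ : {m : ℕ} → Pred (Word m) 0ℓ → Word m → Pred (Word m) 0ℓ
  (S +S w) x = ∃ λ r → S r × (∀ α → x α ≡ r α + w α)

  Coset : {m : ℕ} → 𝔄 m → Pred (Word m) 0ℓ
  Coset δ = R δ +S (λ α → bar (proj₁ δ) α + - (e δ α))

  Disjoint : {m : ℕ} → Pred (Word m) 0ℓ → Pred (Word m) 0ℓ → Set
  Disjoint S S' = ∀ x → S x → S' x → ⊥

  dist : {m : ℕ} → Vec F m → Vec F m → ℕ
  dist [] [] = 0
  dist (x ∷ v) (y ∷ w) = (if ⌊ x ≟F y ⌋ then 0 else 1) +ℕ dist v w

  FirstIs1 : {m : ℕ} → Vec F m → Set
  FirstIs1 [] = ⊥
  FirstIs1 (x ∷ _) = x ≡ 1#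

module Submission where

-- Write δ = (1, δ'), κ = (1, κ').  For a function h : F^m → F pair a word y with h by
-- ⟨y, h⟩ = Σ_{α ∈ 𝔄} y_α h(α); this is linear in y.  We build one test function h such
-- that ⟨·, h⟩ is constant on each of the two cosets, with different constants:
--
--  * From dist(δ', κ') ≥ 3 we construct vectors c₁, c₂ with c_i·δ' = c_i·κ' whose
--    "selection vector" (c₁ where c₂ vanishes, 0 elsewhere) distinguishes δ' from κ'
--    (functional-pair).  Lifting them to C_i = (−c_i·δ', c_i) gives linear forms
--    vanishing at δ and at κ.
--  * h(v) = C₁·v if C₂·v = 0 and 0 otherwise (the selector).  If C₁, C₂ vanish at γ,
--    then ⟨y, h⟩ = 0 for every weight-three codeword y with y_γ = 1, since both forms
--    annihilate codewords and y has only two further nonzero coordinates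
--    (three-point-select); by linearity ⟨·, h⟩ vanishes on R_γ, and on the coset
--    R_γ + γ̄ − e^(γ) it takes the value Σ_i γ_i h(π^(i)) (coset-value).
--  * Comparing the two values at a common element gives δ·Z = κ·Z where Z, the vector of
--    values h(π^(i)), is the selection vector of C₁, C₂: a contradiction.

open import Defs
open import Level using (0ℓ)
open import Data.Nat using (ℕ; zero; suc; _≤_; s≤s⁻¹)
open import Data.Nat.Properties using (suc-injective)
open import Data.Fin using () renaming (_≟_ to _≟F_)
open import Data.Bool using (true; false; if_then_else_; _∧_; T)
open import Data.Unit using (tt)
open import Data.Empty using (⊥-elim)
open import Data.List using (List; []; _∷_; map; concat; concatMap; foldr; length; filter; _++_; tabulate)
open import Data.List.Properties using (length-removeAt′)
open import Data.List.Relation.Unary.Any using (here; there; _─_; index)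
import Data.List.Relation.Unary.Any as Any
open import Data.List.Relation.Unary.All using (All; []; _∷_; universal)
import Data.List.Relation.Unary.All as All
open import Data.List.Relation.Unary.Unique.Propositional using (Unique; []; _∷_)
open import Data.List.Relation.Unary.Unique.Propositional.Properties using (allFin⁺)
open import Data.List.Membership.Propositional using (_∈_)
open import Data.List.Membership.Propositional.Properties using (∈-filter⁺; ∈-map⁺; ∈-concatMap⁺; ∈-tabulate⁺)
open import Data.Vec using (Vec; []; _∷_; replicate; zipWith)
open import Data.Vec.Properties using () renaming (≡-dec to ≡-decVec)
open import Data.Product using (∃; ∃₂; _×_; _,_; proj₁; proj₂)
open import Relation.Nullary using (¬_; yes; no; ¬?)
open import Relation.Nullary.Decidable using (⌊_⌋; decidable-stable)
open import Relation.Unary using (Pred; Decidable)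
open import Relation.Binary.PropositionalEquality
open import Algebra.Bundles using (CommutativeRing)
import Algebra.Properties.Ring as RingProperties
import Algebra.Properties.CommutativeSemigroup as CommutativeSemigroupProperties

module Development {q : ℕ} (𝔽 : FiniteField q) where
  open FiniteField 𝔽
  open HammingDefs 𝔽

  commutativeRing : CommutativeRing 0ℓ 0ℓ
  commutativeRing = record { isCommutativeRing = isCommutativeRing }

  open CommutativeRing commutativeRing using (+-assoc; +-comm; +-identityˡ; +-identityʳ;
    -‿inverseˡ; -‿inverseʳ; *-assoc; *-comm; *-identityˡ; *-identityʳ; distribˡ; distribʳ;
    zeroˡ; zeroʳ; ring; +-commutativeSemigroup; *-commutativeSemigroup)
  open RingProperties ring using (-‿involutive; -0#≈0#; -‿distribˡ-*; -‿distribʳ-*;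
    -‿anti-homo-+; +-inverseʳ-unique)
  open CommutativeSemigroupProperties +-commutativeSemigroup using (interchange; x∙yz≈y∙xz)
  open CommutativeSemigroupProperties *-commutativeSemigroup using ()
    renaming (x∙yz≈y∙xz to *-x∙yz≈y∙xz)
  open ≡-Reasoning

  infixl 6 _−_
  _−_ : F → F → F
  x − y = x + - y

  −≡0⇒≡ : ∀ x y → x − y ≡ 0# → x ≡ y
  −≡0⇒≡ x y x−y≡0 = begin
    x              ≡⟨ sym (+-identityʳ x) ⟩
    x + 0#         ≡⟨ cong (x +_) (sym (-‿inverseˡ y)) ⟩
    x + (- y + y)  ≡⟨ sym (+-assoc x (- y) y) ⟩
    (x − y) + y    ≡⟨ cong (_+ y) x−y≡0 ⟩
    0# + y         ≡⟨ +-identityˡ y ⟩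
    y              ∎

  *-distribˡ-− : ∀ c x y → c * x − c * y ≡ c * (x − y)
  *-distribˡ-− c x y = begin
    c * x + - (c * y)  ≡⟨ cong (c * x +_) (-‿distribʳ-* c y) ⟩
    c * x + c * - y    ≡⟨ sym (distribˡ c x (- y)) ⟩
    c * (x − y)        ∎

  -- A field has no zero divisors; this is the only use of the inverses.
  *-≢0 : ∀ {a b} → a ≢ 0# → b ≢ 0# → a * b ≢ 0#
  *-≢0 {a} {b} a≢0 b≢0 ab≡0 with inverse a a≢0
  ... | i , ai≡1 = b≢0 (begin
    b            ≡⟨ sym (*-identityˡ b) ⟩
    1# * b       ≡⟨ cong (_* b) (sym ai≡1) ⟩
    a * i * b    ≡⟨ cong (_* b) (*-comm a i) ⟩
    i * a * b    ≡⟨ *-assoc i a b ⟩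
    i * (a * b)  ≡⟨ cong (i *_) ab≡0 ⟩
    i * 0#       ≡⟨ zeroʳ i ⟩
    0#           ∎)

  -- select p r is r when p vanishes and 0 otherwise.  Applied to two linear forms it
  -- gives the (non-linear) test function of the main argument.
  select : F → F → F
  select p r = if ⌊ p ≟F 0# ⌋ then r else 0#

  select-on : ∀ {p} r → p ≡ 0# → select p r ≡ r
  select-on {p} r p≡0 with p ≟F 0#
  ... | yes _  = refl
  ... | no p≢0 = ⊥-elim (p≢0 p≡0)

  select-off : ∀ {p} r → p ≢ 0# → select p r ≡ 0#
  select-off {p} r p≢0 with p ≟F 0#
  ... | yes p≡0 = ⊥-elim (p≢0 p≡0)
  ... | no _    = refl

  select-null : ∀ p {r} → r ≡ 0# → select p r ≡ 0#
  select-null p r≡0 with p ≟F 0#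
  ... | yes _ = r≡0
  ... | no _  = refl

  -- Selection commutes with scaling, because a * p vanishes iff a or p does.
  select-scale : ∀ a p r → a * select p r ≡ select (a * p) (a * r)
  select-scale a p r with a ≟F 0# | p ≟F 0#
  ... | yes refl | _       = trans (zeroˡ _) (sym (select-null (0# * p) (zeroˡ r)))
  ... | no a≢0  | yes refl = sym (select-on (a * r) (zeroʳ a))
  ... | no a≢0  | no p≢0   = trans (zeroʳ a) (sym (select-off (a * r) (*-≢0 a≢0 p≢0)))

  select-cancel : ∀ p r p′ r′ → p + p′ ≡ 0# → r + r′ ≡ 0# → select p r + select p′ r′ ≡ 0#
  select-cancel p r p′ r′ p+p′≡0 r+r′≡0
    rewrite +-inverseʳ-unique p p′ p+p′≡0 | +-inverseʳ-unique r r′ r+r′≡0 with p ≟F 0#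
  ... | yes p≡0 = begin
    r + select (- p) (- r)  ≡⟨ cong (r +_) (select-on (- r) (trans (cong -_ p≡0) -0#≈0#)) ⟩
    r − r                   ≡⟨ -‿inverseʳ r ⟩
    0#                      ∎
  ... | no p≢0 = begin
    0# + select (- p) (- r)  ≡⟨ cong (0# +_) (select-off (- r) -p≢0) ⟩
    0# + 0#                  ≡⟨ +-identityˡ 0# ⟩
    0#                       ∎
    where
    -p≢0 : - p ≢ 0#
    -p≢0 -p≡0 = p≢0 (trans (sym (-‿involutive p)) (trans (cong -_ -p≡0) -0#≈0#))

  zeros : ∀ n → Vec F n
  zeros n = replicate n 0#

  dot : ∀ {n} → Vec F n → Vec F n → F
  dot []       []       = 0#
  dot (c ∷ cs) (x ∷ xs) = c * x + dot cs xs

  dot-comm : ∀ {n} (u v : Vec F n) → dot u v ≡ dot v u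
  dot-comm []       []       = refl
  dot-comm (u ∷ us) (v ∷ vs) = cong₂ _+_ (*-comm u v) (dot-comm us vs)

  dot-zerosʳ : ∀ {n} (c : Vec F n) → dot c (zeros n) ≡ 0#
  dot-zerosʳ []       = refl
  dot-zerosʳ (c ∷ cs) = trans (cong₂ _+_ (zeroʳ c) (dot-zerosʳ cs)) (+-identityˡ 0#)

  dot-scale : ∀ {n} s (u x : Vec F n) → dot (s ·v u) x ≡ s * dot u x
  dot-scale s []       []       = sym (zeroʳ s)
  dot-scale s (u ∷ us) (x ∷ xs) = begin
    s * u * x + dot (s ·v us) xs  ≡⟨ cong₂ _+_ (*-assoc s u x) (dot-scale s us xs) ⟩
    s * (u * x) + s * dot us xs   ≡⟨ sym (distribˡ s _ _) ⟩
    s * (u * x + dot us xs)       ∎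

  -- Linearity of x ↦ c·x, in the shape in which the syndrome is accumulated.
  dot-linear : ∀ {n} (c : Vec F n) a (x w : Vec F n) →
               dot c ((a ·v x) +v w) ≡ a * dot c x + dot c w
  dot-linear []       a []       []       = sym (trans (+-identityʳ _) (zeroʳ a))
  dot-linear (c ∷ cs) a (x ∷ xs) (w ∷ ws) = begin
    c * (a * x + w) + dot cs ((a ·v xs) +v ws)
      ≡⟨ cong₂ _+_ (distribˡ c (a * x) w) (dot-linear cs a xs ws) ⟩
    (c * (a * x) + c * w) + (a * dot cs xs + dot cs ws)
      ≡⟨ cong (λ t → (t + c * w) + (a * dot cs xs + dot cs ws)) (*-x∙yz≈y∙xz c a x) ⟩
    (a * (c * x) + c * w) + (a * dot cs xs + dot cs ws)
      ≡⟨ interchange _ _ _ _ ⟩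
    (a * (c * x) + a * dot cs xs) + (c * w + dot cs ws)
      ≡⟨ cong (_+ (c * w + dot cs ws)) (sym (distribˡ a _ _)) ⟩
    a * (c * x + dot cs xs) + (c * w + dot cs ws)
      ∎

  gap : ∀ {n} → Vec F n → Vec F n → Vec F n → F
  gap c α β = dot c α − dot c β

  gap-cons : ∀ {n} c (cs : Vec F n) x y α β →
             gap (c ∷ cs) (x ∷ α) (y ∷ β) ≡ c * (x − y) + gap cs α β
  gap-cons c cs x y α β = begin
    (c * x + dot cs α) + - (c * y + dot cs β)
      ≡⟨ cong ((c * x + dot cs α) +_) (-‿anti-homo-+ (c * y) (dot cs β)) ⟩
    (c * x + dot cs α) + (- dot cs β + - (c * y))
      ≡⟨ cong ((c * x + dot cs α) +_) (+-comm (- dot cs β) (- (c * y))) ⟩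
    (c * x + dot cs α) + (- (c * y) + - dot cs β)
      ≡⟨ interchange (c * x) (dot cs α) (- (c * y)) (- dot cs β) ⟩
    (c * x − c * y) + gap cs α β
      ≡⟨ cong (_+ gap cs α β) (*-distribˡ-− c x y) ⟩
    c * (x − y) + gap cs α β
      ∎

  gap-same-head : ∀ {n} c (cs : Vec F n) x α β → gap (c ∷ cs) (x ∷ α) (x ∷ β) ≡ gap cs α β
  gap-same-head c cs x α β = begin
    gap (c ∷ cs) (x ∷ α) (x ∷ β)  ≡⟨ gap-cons c cs x x α β ⟩
    c * (x − x) + gap cs α β      ≡⟨ cong (λ t → c * t + gap cs α β) (-‿inverseʳ x) ⟩
    c * 0# + gap cs α β           ≡⟨ cong (_+ gap cs α β) (zeroʳ c) ⟩
    0# + gap cs α β               ≡⟨ +-identityˡ _ ⟩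
    gap cs α β                    ∎

  gap-zeros : ∀ {n} (α β : Vec F n) → gap (zeros n) α β ≡ 0#
  gap-zeros α β = begin
    dot (zeros _) α − dot (zeros _) β  ≡⟨ cong₂ _−_ (zeros-dot α) (zeros-dot β) ⟩
    0# − 0#                            ≡⟨ -‿inverseʳ 0# ⟩
    0#                                 ∎
    where
    zeros-dot : ∀ {n} (x : Vec F n) → dot (zeros n) x ≡ 0#
    zeros-dot x = trans (dot-comm (zeros _) x) (dot-zerosʳ x)

  gap-scale : ∀ {n} s (u α β : Vec F n) → gap (s ·v u) α β ≡ s * gap u α β
  gap-scale s u α β =
    trans (cong₂ _−_ (dot-scale s u α) (dot-scale s u β)) (*-distribˡ-− s (dot u α) (dot u β))

  gap-first : ∀ {n} x y (α β : Vec F n) → gap (1# ∷ zeros n) (x ∷ α) (y ∷ β) ≡ x − y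
  gap-first x y α β = begin
    gap (1# ∷ zeros _) (x ∷ α) (y ∷ β)  ≡⟨ gap-cons 1# (zeros _) x y α β ⟩
    1# * (x − y) + gap (zeros _) α β    ≡⟨ cong₂ _+_ (*-identityˡ (x − y)) (gap-zeros α β) ⟩
    (x − y) + 0#                        ≡⟨ +-identityʳ (x − y) ⟩
    x − y                               ∎

  -- Prepending the gap g of u, and scaling u by −(x − y), yields a form that does not
  -- distinguish x ∷ α from y ∷ β: the two contributions g(x − y) cancel.
  balance : ∀ {n} (u α β : Vec F n) x y →
            gap (gap u α β ∷ (- (x − y)) ·v u) (x ∷ α) (y ∷ β) ≡ 0#
  balance u α β x y = begin
    gap (g ∷ (- a) ·v u) (x ∷ α) (y ∷ β)  ≡⟨ gap-cons g ((- a) ·v u) x y α β ⟩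
    g * a + gap ((- a) ·v u) α β          ≡⟨ cong (g * a +_) (gap-scale (- a) u α β) ⟩
    g * a + - a * g                       ≡⟨ cong (g * a +_) (sym (-‿distribˡ-* a g)) ⟩
    g * a + - (a * g)                     ≡⟨ cong (λ t → g * a + - t) (*-comm a g) ⟩
    g * a − g * a                         ≡⟨ -‿inverseʳ (g * a) ⟩
    0#                                    ∎
    where
    g = gap u α β
    a = x − y

  dist-same-head : ∀ {n} x (v w : Vec F n) → dist (x ∷ v) (x ∷ w) ≡ dist v w
  dist-same-head x v w with x ≟F x
  ... | yes _ = refl
  ... | no x≢x = ⊥-elim (x≢x refl)

  separating : ∀ {n} (α β : Vec F n) → 1 ≤ dist α β → ∃ λ e → gap e α β ≢ 0#
  separating [] [] ()
  separating (x ∷ α) (y ∷ β) far with x ≟F y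
  separating (x ∷ α) (.x ∷ β) far | yes refl with separating α β far
  ... | e , e-sep = 0# ∷ e , λ gap≡0 → e-sep (trans (sym (gap-same-head 0# e x α β)) gap≡0)
  separating (x ∷ α) (y ∷ β) far | no x≢y =
    1# ∷ zeros _ , λ gap≡0 → x≢y (−≡0⇒≡ x y (trans (sym (gap-first x y α β)) gap≡0))

  selection : ∀ {n} → Vec F n → Vec F n → Vec F n
  selection c₂ c₁ = zipWith select c₂ c₁

  selection-zeros : ∀ {n} (c : Vec F n) s → selection c (s ·v zeros n) ≡ zeros n
  selection-zeros []      s = refl
  selection-zeros (c ∷ cs) s = cong₂ _∷_ (select-null c (zeroʳ s)) (selection-zeros cs s)

  masked-separator : ∀ {n} (α β : Vec F n) → 2 ≤ dist α β →
    ∃₂ λ u c → gap u α β ≢ 0# × gap c α β ≡ 0# × (∀ s → gap (selection c (s ·v u)) α β ≡ 0#)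
  masked-separator [] [] ()
  masked-separator (x ∷ α) (y ∷ β) far with x ≟F y
  masked-separator (x ∷ α) (.x ∷ β) far | yes refl with masked-separator α β far
  ... | u , c , u-sep , c-blind , masked =
    0# ∷ u , 0# ∷ c ,
    (λ gap≡0 → u-sep (trans (sym (gap-same-head 0# u x α β)) gap≡0)) ,
    trans (gap-same-head 0# c x α β) c-blind ,
    λ s → trans (gap-same-head (select 0# (s * 0#)) (selection c (s ·v u)) x α β) (masked s)
  masked-separator (x ∷ α) (y ∷ β) far | no x≢y with separating α β (s≤s⁻¹ far)
  ... | e , e-sep =
    1# ∷ zeros _ , gap e α β ∷ (- (x − y)) ·v e ,
    (λ gap≡0 → x≢y (−≡0⇒≡ x y (trans (sym (gap-first x y α β)) gap≡0))) ,
    balance e α β x y ,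
    masked
    where
    masked : ∀ s → gap (selection (gap e α β ∷ (- (x − y)) ·v e) (s ·v (1# ∷ zeros _))) (x ∷ α) (y ∷ β) ≡ 0#
    masked s = begin
      gap (select (gap e α β) (s * 1#) ∷ selection ((- (x − y)) ·v e) (s ·v zeros _)) (x ∷ α) (y ∷ β)
        ≡⟨ gap-cons (select (gap e α β) (s * 1#)) (selection ((- (x − y)) ·v e) (s ·v zeros _)) x y α β ⟩
      select (gap e α β) (s * 1#) * (x − y) + gap (selection ((- (x − y)) ·v e) (s ·v zeros _)) α β
        ≡⟨ cong₂ _+_ (trans (cong (_* (x − y)) (select-off (s * 1#) e-sep)) (zeroˡ (x − y)))
                     (trans (cong (λ c → gap c α β) (selection-zeros ((- (x − y)) ·v e) s)) (gap-zeros α β)) ⟩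
      0# + 0#
        ≡⟨ +-identityˡ 0# ⟩
      0#
        ∎

  functional-pair : ∀ {n} (α β : Vec F n) → 3 ≤ dist α β →
    ∃₂ λ c₁ c₂ → gap c₁ α β ≡ 0# × gap c₂ α β ≡ 0# × gap (selection c₂ c₁) α β ≢ 0#
  functional-pair [] [] ()
  functional-pair (x ∷ α) (y ∷ β) far with x ≟F y
  functional-pair (x ∷ α) (.x ∷ β) far | yes refl with functional-pair α β far
  ... | c₁ , c₂ , c₁-blind , c₂-blind , separates =
    0# ∷ c₁ , 0# ∷ c₂ ,
    trans (gap-same-head 0# c₁ x α β) c₁-blind ,
    trans (gap-same-head 0# c₂ x α β) c₂-blind ,
    λ gap≡0 → separates (trans (sym (gap-same-head (select 0# 0#) (selection c₂ c₁) x α β)) gap≡0)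
  functional-pair (x ∷ α) (y ∷ β) far | no x≢y with masked-separator α β (s≤s⁻¹ far)
  ... | u , c , u-sep , c-blind , masked =
    gap u α β ∷ (- (x − y)) ·v u , 0# ∷ c ,
    balance u α β x y ,
    trans (gap-cons 0# c x y α β) (trans (cong₂ _+_ (zeroˡ (x − y)) c-blind) (+-identityˡ 0#)) ,
    λ gap≡0 → *-≢0 x−y≢0 u-sep (trans (sym selection-gap) gap≡0)
    where
    x−y≢0 : x − y ≢ 0#
    x−y≢0 x−y≡0 = x≢y (−≡0⇒≡ x y x−y≡0)
    selection-gap : gap (selection (0# ∷ c) (gap u α β ∷ (- (x − y)) ·v u)) (x ∷ α) (y ∷ β)
                    ≡ (x − y) * gap u α β
    selection-gap = begin
      gap (select 0# (gap u α β) ∷ selection c ((- (x − y)) ·v u)) (x ∷ α) (y ∷ β)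
        ≡⟨ gap-cons (select 0# (gap u α β)) (selection c ((- (x − y)) ·v u)) x y α β ⟩
      select 0# (gap u α β) * (x − y) + gap (selection c ((- (x − y)) ·v u)) α β
        ≡⟨ cong₂ _+_ (cong (_* (x − y)) (select-on (gap u α β) refl)) (masked (- (x − y))) ⟩
      gap u α β * (x − y) + 0#
        ≡⟨ trans (+-identityʳ _) (*-comm (gap u α β) (x − y)) ⟩
      (x − y) * gap u α β
        ∎

  lift : ∀ {n} → Vec F n → Vec F n → Vec F (suc n)
  lift δ′ c = - dot c δ′ ∷ c

  lift-annihilates : ∀ {n} (δ′ κ′ c : Vec F n) → gap c δ′ κ′ ≡ 0# → dot (lift δ′ c) (1# ∷ κ′) ≡ 0#
  lift-annihilates δ′ κ′ c c-blind = begin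
    - dot c δ′ * 1# + dot c κ′  ≡⟨ cong₂ _+_ (*-identityʳ _) (sym (−≡0⇒≡ _ _ c-blind)) ⟩
    - dot c δ′ + dot c δ′       ≡⟨ -‿inverseˡ (dot c δ′) ⟩
    0#                          ∎

  sumL : ∀ {A : Set} → List A → (A → F) → F
  sumL L f = foldr (λ v acc → f v + acc) 0# L

  sum-cong : ∀ {A : Set} (L : List A) {f g : A → F} → (∀ v → f v ≡ g v) → sumL L f ≡ sumL L g
  sum-cong []      f≗g = refl
  sum-cong (x ∷ L) f≗g = cong₂ _+_ (f≗g x) (sum-cong L f≗g)

  sum-zero : ∀ {A : Set} {L : List A} {f : A → F} → All (λ v → f v ≡ 0#) L → sumL L f ≡ 0#
  sum-zero []             = refl
  sum-zero (fx≡0 ∷ rest) = trans (cong₂ _+_ fx≡0 (sum-zero rest)) (+-identityˡ 0#)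

  sum-+ : ∀ {A : Set} (L : List A) (f g : A → F) → sumL L (λ v → f v + g v) ≡ sumL L f + sumL L g
  sum-+ []      f g = sym (+-identityˡ 0#)
  sum-+ (x ∷ L) f g = trans (cong ((f x + g x) +_) (sum-+ L f g)) (interchange _ _ _ _)

  sum-*ˡ : ∀ {A : Set} (L : List A) a (f : A → F) → sumL L (λ v → a * f v) ≡ a * sumL L f
  sum-*ˡ []      a f = sym (zeroʳ a)
  sum-*ˡ (x ∷ L) a f = trans (cong (a * f x +_) (sum-*ˡ L a f)) (sym (distribˡ a _ _))

  sum-neg : ∀ {A : Set} (L : List A) (f : A → F) → sumL L (λ v → - f v) ≡ - sumL L f
  sum-neg []      f = sym -0#≈0#
  sum-neg (x ∷ L) f =
    trans (cong (- f x +_) (sum-neg L f)) (trans (+-comm _ _) (sym (-‿anti-homo-+ _ _)))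

  sum-++ : ∀ {A : Set} (L M : List A) (f : A → F) → sumL (L ++ M) f ≡ sumL L f + sumL M f
  sum-++ []      M f = sym (+-identityˡ _)
  sum-++ (x ∷ L) M f = trans (cong (f x +_) (sum-++ L M f)) (sym (+-assoc _ _ _))

  sum-map : ∀ {A B : Set} (L : List A) (h : A → B) (f : B → F) → sumL (map h L) f ≡ sumL L (λ v → f (h v))
  sum-map []      h f = refl
  sum-map (x ∷ L) h f = cong (f (h x) +_) (sum-map L h f)

  sum-concatMap : ∀ {A B : Set} (L : List A) (h : A → List B) (f : B → F) →
                  sumL (concatMap h L) f ≡ sumL L (λ x → sumL (h x) f)
  sum-concatMap []      h f = refl
  sum-concatMap (x ∷ L) h f =
    trans (sum-++ (h x) (concat (map h L)) f) (cong (sumL (h x) f +_) (sum-concatMap L h f))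

  sum-filter : ∀ {A : Set} {P : A → Set} (P? : Decidable P) (L : List A) (f : A → F) →
               (∀ v → ¬ P v → f v ≡ 0#) → sumL L f ≡ sumL (filter P? L) f
  sum-filter P? []      f off = refl
  sum-filter P? (x ∷ L) f off with P? x
  ... | yes _ = cong (f x +_) (sum-filter P? L f off)
  ... | no ¬Px = trans (cong (_+ sumL L f) (off x ¬Px)) (trans (+-identityˡ _) (sum-filter P? L f off))

  sum-─ : ∀ {A : Set} {L : List A} {γ} (γ∈L : γ ∈ L) (f : A → F) →
          sumL L f ≡ f γ + sumL (L ─ γ∈L) f
  sum-─ (here refl) f = refl
  sum-─ {L = x ∷ L} (there γ∈L) f = trans (cong (f x +_) (sum-─ γ∈L f)) (x∙yz≈y∙xz (f x) _ _)

  sum-unique-point : ∀ {A : Set} {L : List A} {c} (f : A → F) → Unique L → c ∈ L →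
                     (∀ x → x ≢ c → f x ≡ 0#) → sumL L f ≡ f c
  sum-unique-point f (c≢L ∷ _) (here refl) off =
    trans (cong (f _ +_) (sum-zero (All.map (λ c≢x → off _ (λ x≡c → c≢x (sym x≡c))) c≢L)))
          (+-identityʳ _)
  sum-unique-point f (x≢L ∷ unique) (there c∈L) off =
    trans (cong₂ _+_ (off _ (All.lookup x≢L c∈L)) (sum-unique-point f unique c∈L off))
          (+-identityˡ _)

  pair-select : ∀ {A : Set} (K : List A) → length K ≡ 2 → (p r : A → F) →
                sumL K p ≡ 0# → sumL K r ≡ 0# → sumL K (λ v → select (p v) (r v)) ≡ 0#
  pair-select (v ∷ w ∷ []) refl p r Σp≡0 Σr≡0 = begin
    select (p v) (r v) + (select (p w) (r w) + 0#)
      ≡⟨ cong (select (p v) (r v) +_) (+-identityʳ _) ⟩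
    select (p v) (r v) + select (p w) (r w)
      ≡⟨ select-cancel _ _ _ _ (two Σp≡0) (two Σr≡0) ⟩
    0#
      ∎
    where
    two : ∀ {a b} → a + (b + 0#) ≡ 0# → a + b ≡ 0#
    two {a} {b} = trans (cong (a +_) (sym (+-identityʳ b)))

  three-point-select : ∀ {A : Set} (L : List A) {γ} (γ∈L : γ ∈ L) → length L ≡ 3 → (p r : A → F) →
    sumL L p ≡ 0# → sumL L r ≡ 0# → p γ ≡ 0# → r γ ≡ 0# → sumL L (λ v → select (p v) (r v)) ≡ 0#
  three-point-select L γ∈L three p r Σp≡0 Σr≡0 pγ≡0 rγ≡0 = begin
    sumL L s                           ≡⟨ sum-─ γ∈L s ⟩
    s _ + sumL (L ─ γ∈L) s             ≡⟨ cong₂ _+_ (select-null (p _) rγ≡0)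
                                            (pair-select (L ─ γ∈L) two p r (rest p Σp≡0 pγ≡0) (rest r Σr≡0 rγ≡0)) ⟩
    0# + 0#                            ≡⟨ +-identityˡ 0# ⟩
    0#                                 ∎
    where
    s = λ v → select (p v) (r v)
    two : length (L ─ γ∈L) ≡ 2
    two = suc-injective (trans (sym (length-removeAt′ L (index γ∈L))) three)
    rest : (f : _ → F) → sumL L f ≡ 0# → f _ ≡ 0# → sumL (L ─ γ∈L) f ≡ 0#
    rest f Σf≡0 fγ≡0 = begin
      sumL (L ─ γ∈L) f         ≡⟨ sym (+-identityˡ _) ⟩
      0# + sumL (L ─ γ∈L) f    ≡⟨ cong (_+ sumL (L ─ γ∈L) f) (sym fγ≡0) ⟩
      f _ + sumL (L ─ γ∈L) f   ≡⟨ sym (sum-─ γ∈L f) ⟩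
      sumL L f                 ≡⟨ Σf≡0 ⟩
      0#                       ∎

  allF : List F
  allF = tabulate (λ i → i)

  pick : F → F → F → F
  pick c A x = if ⌊ x ≟F c ⌋ then A else 0#

  sum-pick : ∀ c A → sumL allF (pick c A) ≡ A
  sum-pick c A = trans (sum-unique-point (pick c A) (allFin⁺ q) (∈-tabulate⁺ c) off) on
    where
    off : ∀ x → x ≢ c → pick c A x ≡ 0#
    off x x≢c with x ≟F c
    ... | yes x≡c = ⊥-elim (x≢c x≡c)
    ... | no _    = refl
    on : pick c A c ≡ A
    on with c ≟F c
    ... | yes _ = refl
    ... | no c≢c = ⊥-elim (c≢c refl)

  sum-allVec-suc : ∀ m (f : Vec F (suc m) → F) →
                   sumL (allVec (suc m)) f ≡ sumL allF (λ x → sumL (allVec m) (λ v → f (x ∷ v)))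
  sum-allVec-suc m f =
    trans (sum-concatMap allF _ f) (sum-cong allF (λ x → sum-map (allVec m) (x ∷_) f))

  ∈-allVec : ∀ m (v : Vec F m) → v ∈ allVec m
  ∈-allVec zero    []      = here refl
  ∈-allVec (suc m) (x ∷ v) = ∈-concatMap⁺ (λ y → map (y ∷_) (allVec m))
    (Any.map (λ { refl → ∈-map⁺ (x ∷_) (∈-allVec m v) }) (∈-tabulate⁺ {f = λ i → i} x))

  unitImages : ∀ {m} → (Vec F m → F) → Vec F m
  unitImages {zero}  h = []
  unitImages {suc m} h = h (1# ∷ zeros m) ∷ unitImages (λ w → h (0# ∷ w))

  unitImages-cong : ∀ {m} {g h : Vec F m → F} → (∀ w → g w ≡ h w) → unitImages g ≡ unitImages h
  unitImages-cong {zero}  g≗h = refl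
  unitImages-cong {suc m} g≗h = cong₂ _∷_ (g≗h _) (unitImages-cong (λ w → g≗h (0# ∷ w)))

  unitImages-dot : ∀ {m} (c : Vec F m) → unitImages (dot c) ≡ c
  unitImages-dot []       = refl
  unitImages-dot (c ∷ cs) = cong₂ _∷_
    (trans (cong₂ _+_ (*-identityʳ c) (dot-zerosʳ cs)) (+-identityʳ c))
    (trans (unitImages-cong (λ w → trans (cong (_+ dot cs w) (zeroʳ c)) (+-identityˡ _)))
           (unitImages-dot cs))

  unitImages-zipWith : ∀ {m} (f : F → F → F) (g h : Vec F m → F) →
    unitImages (λ w → f (g w) (h w)) ≡ zipWith f (unitImages g) (unitImages h)
  unitImages-zipWith {zero}  f g h = refl
  unitImages-zipWith {suc m} f g h =
    cong (f (g (1# ∷ zeros m)) (h (1# ∷ zeros m)) ∷_)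
         (unitImages-zipWith f (λ w → g (0# ∷ w)) (λ w → h (0# ∷ w)))

  sum-at-zero : ∀ m a (h : Vec F m → F) →
                sumL (allVec m) (λ v → (if allZero v then a else 0#) * h v) ≡ a * h (zeros m)
  sum-at-zero zero    a h = +-identityʳ _
  sum-at-zero (suc m) a h =
    trans (sum-allVec-suc m _)
          (trans (sum-cong allF split) (sum-pick 0# (a * h (zeros (suc m)))))
    where
    split : ∀ x → sumL (allVec m) (λ v → (if ⌊ x ≟F 0# ⌋ ∧ allZero v then a else 0#) * h (x ∷ v))
                  ≡ pick 0# (a * h (zeros (suc m))) x
    split x with x ≟F 0#
    ... | yes refl = sum-at-zero m a (λ w → h (0# ∷ w))
    ... | no _     = sum-zero (universal (λ v → zeroˡ _) (allVec m))

  ext-at : ∀ b (g : T b → F) (p : T b) → ext b g ≡ g p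
  ext-at true g tt = refl

  ext-cong : ∀ b {g k : T b → F} → (∀ p → g p ≡ k p) → ext b g ≡ ext b k
  ext-cong true  g≗k = g≗k tt
  ext-cong false g≗k = refl

  ext-zero : ∀ b (g : T b → F) → (∀ p → g p ≡ 0#) → ext b g ≡ 0#
  ext-zero true  g g≡0 = g≡0 tt
  ext-zero false g g≡0 = refl

  ext-map : ∀ b (f : F → F) (g : T b → F) → f 0# ≡ 0# → ext b (λ p → f (g p)) ≡ f (ext b g)
  ext-map true  f g f0≡0 = refl
  ext-map false f g f0≡0 = sym f0≡0

  ext-map₂ : ∀ b (f : F → F → F) (g k : T b → F) → f 0# 0# ≡ 0# →
             ext b (λ p → f (g p) (k p)) ≡ f (ext b g) (ext b k)
  ext-map₂ true  f g k f00≡0 = refl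
  ext-map₂ false f g k f00≡0 = sym f00≡0

  pairing : ∀ {m} → Word m → (Vec F m → F) → F
  pairing {m} y h = sumL (allVec m) (λ v → coord y v * h v)

  pairing-cong : ∀ {m} {x y : Word m} (h : Vec F m → F) → (∀ α → x α ≡ y α) → pairing x h ≡ pairing y h
  pairing-cong {m} h x≗y =
    sum-cong (allVec m) (λ v → cong (_* h v) (ext-cong (isNorm v) (λ p → x≗y (v , p))))

  pairing-0w : ∀ {m} (h : Vec F m → F) → pairing 0w h ≡ 0#
  pairing-0w {m} h = sum-zero (universal term (allVec m))
    where
    term : ∀ v → coord 0w v * h v ≡ 0#
    term v = trans (cong (_* h v) (ext-zero (isNorm v) _ (λ _ → refl))) (zeroˡ (h v))

  pairing-+ : ∀ {m} (y z : Word m) (h : Vec F m → F) →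
              pairing (λ α → y α + z α) h ≡ pairing y h + pairing z h
  pairing-+ {m} y z h = trans (sum-cong (allVec m) term) (sum-+ (allVec m) _ _)
    where
    term : ∀ v → coord (λ α → y α + z α) v * h v ≡ coord y v * h v + coord z v * h v
    term v = trans (cong (_* h v) (ext-map₂ (isNorm v) _+_ _ _ (+-identityˡ 0#))) (distribʳ (h v) _ _)

  pairing-scale : ∀ {m} a (y : Word m) (h : Vec F m → F) → pairing (λ α → a * y α) h ≡ a * pairing y h
  pairing-scale {m} a y h = trans (sum-cong (allVec m) term) (sum-*ˡ (allVec m) a _)
    where
    term : ∀ v → coord (λ α → a * y α) v * h v ≡ a * (coord y v * h v)
    term v = trans (cong (_* h v) (ext-map (isNorm v) (a *_) _ (zeroʳ a))) (*-assoc a _ _)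

  pairing-neg : ∀ {m} (y : Word m) (h : Vec F m → F) → pairing (λ α → - y α) h ≡ - pairing y h
  pairing-neg {m} y h = trans (sum-cong (allVec m) term) (sum-neg (allVec m) _)
    where
    term : ∀ v → coord (λ α → - y α) v * h v ≡ - (coord y v * h v)
    term v = trans (cong (_* h v) (ext-map (isNorm v) -_ _ -0#≈0#)) (sym (-‿distribˡ-* _ _))

  -- ⟨e^(γ), h⟩ = h(γ); we only need the case h(γ) = 0.
  pairing-unit : ∀ {m} (γ : 𝔄 m) (h : Vec F m → F) → h (proj₁ γ) ≡ 0# → pairing (e γ) h ≡ 0#
  pairing-unit {m} γ h hγ≡0 = sum-zero (universal term (allVec m))
    where
    at : ∀ v → (if ⌊ ≡-decVec _≟F_ v (proj₁ γ) ⌋ then 1# else 0#) * h v ≡ 0#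
    at v with ≡-decVec _≟F_ v (proj₁ γ)
    ... | yes refl = trans (*-identityˡ _) hγ≡0
    ... | no _     = zeroˡ (h v)
    term : ∀ v → coord (e γ) v * h v ≡ 0#
    term v = trans (sym (ext-map (isNorm v) (_* h v) _ (zeroˡ (h v)))) (ext-zero (isNorm v) _ (λ _ → at v))

  pairing-bar : ∀ m (α : Vec F m) (h : Vec F m → F) → pairing (bar α) h ≡ dot α (unitImages h)
  pairing-bar zero    [] h = trans (+-identityʳ _) (zeroˡ _)
  pairing-bar (suc m) (a ∷ α) h =
    trans (sum-allVec-suc m _)
          (trans (sum-cong allF split)
                 (trans (sum-+ allF _ _) (cong₂ _+_ (sum-pick 1# _) (sum-pick 0# _))))
    where
    split : ∀ x →
      sumL (allVec m) (λ v → ext (if ⌊ x ≟F 1# ⌋ then true else (⌊ x ≟F 0# ⌋ ∧ isNorm v))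
             (λ _ → if ⌊ x ≟F 1# ⌋ ∧ allZero v then a else (if ⌊ x ≟F 0# ⌋ then barCoord α v else 0#))
             * h (x ∷ v))
      ≡ pick 1# (a * h (1# ∷ zeros m)) x + pick 0# (dot α (unitImages (λ w → h (0# ∷ w)))) x
    split x with x ≟F 1# | x ≟F 0#
    ... | yes refl | yes 1≡0 = ⊥-elim (0≢1 (sym 1≡0))
    ... | yes refl | no _    = trans (sum-at-zero m a (λ w → h (1# ∷ w))) (sym (+-identityʳ _))
    ... | no _     | yes refl = trans (pairing-bar m α (λ w → h (0# ∷ w))) (sym (+-identityˡ _))
    ... | no _     | no _    = trans (sum-zero (universal (λ v → zeroˡ _) (allVec m))) (sym (+-identityˡ 0#))

  dot-syndrome : ∀ {m} (C : Vec F m) (y : Word m) (L : List (Vec F m)) →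
    dot C (foldr (λ v acc → (coord y v ·v v) +v acc) (zeros m) L) ≡ sumL L (λ v → coord y v * dot C v)
  dot-syndrome C y []      = dot-zerosʳ C
  dot-syndrome C y (v ∷ L) =
    trans (dot-linear C (coord y v) v _) (cong (coord y v * dot C v +_) (dot-syndrome C y L))

  codeword-orthogonal : ∀ {m} (C : Vec F m) (y : Word m) → InHamming y → pairing y (dot C) ≡ 0#
  codeword-orthogonal {m} C y codeword =
    trans (sym (dot-syndrome C y (allVec m))) (trans (cong (dot C) codeword) (dot-zerosʳ C))

  support : ∀ {m} → Word m → List (Vec F m)
  support {m} y = filter (λ v → ¬? (coord y v ≟F 0#)) (allVec m)

  pairing-support : ∀ {m} (y : Word m) (h : Vec F m → F) →
                    pairing y h ≡ sumL (support y) (λ v → coord y v * h v)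
  pairing-support {m} y h = sum-filter _ (allVec m) _
    (λ v ¬nonzero → trans (cong (_* h v) (decidable-stable (coord y v ≟F 0#) ¬nonzero)) (zeroˡ (h v)))

  pairing-span : ∀ {m} {P : Pred (Word m) 0ℓ} (h : Vec F m → F) →
                 (∀ y → P y → pairing y h ≡ 0#) → ∀ {r} → Span P r → pairing r h ≡ 0#
  pairing-span h vanish span-zero = pairing-0w h
  pairing-span h vanish (span-step a y z Py Sz) = begin
    pairing (λ α → a * y α + z α) h          ≡⟨ pairing-+ (λ α → a * y α) z h ⟩
    pairing (λ α → a * y α) h + pairing z h  ≡⟨ cong₂ _+_ (pairing-scale a y h) (pairing-span h vanish Sz) ⟩
    a * pairing y h + 0#                     ≡⟨ cong (λ t → a * t + 0#) (vanish y Py) ⟩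
    a * 0# + 0#                              ≡⟨ trans (+-identityʳ _) (zeroʳ a) ⟩
    0#                                       ∎

  pairing-coset : ∀ {m} {S : Pred (Word m) 0ℓ} {w x : Word m} (h : Vec F m → F) →
                  (∀ r → S r → pairing r h ≡ 0#) → (S +S w) x → pairing x h ≡ pairing w h
  pairing-coset {w = w} h vanish (r , Sr , x≡r+w) = begin
    pairing _ h                  ≡⟨ pairing-cong h x≡r+w ⟩
    pairing (λ α → r α + w α) h  ≡⟨ pairing-+ r w h ⟩
    pairing r h + pairing w h    ≡⟨ cong (_+ pairing w h) (vanish r Sr) ⟩
    0# + pairing w h             ≡⟨ +-identityˡ _ ⟩
    pairing w h                  ∎

  module TestFunction {m : ℕ} (C₁ C₂ : Vec F m) where

    selector : Vec F m → F
    selector v = select (dot C₂ v) (dot C₁ v)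

    selector-images : unitImages selector ≡ selection C₂ C₁
    selector-images =
      trans (unitImages-zipWith select (dot C₂) (dot C₁)) (cong₂ selection (unitImages-dot C₂) (unitImages-dot C₁))

    module _ (γ : 𝔄 m) (C₁γ≡0 : dot C₁ (proj₁ γ) ≡ 0#) (C₂γ≡0 : dot C₂ (proj₁ γ) ≡ 0#) where

      -- A weight-three codeword with y_γ = 1 is orthogonal to the selector: on its
      -- support {γ, v, w} both forms have vanishing weighted sums and vanish at γ.
      triple-vanish : ∀ y → Tset γ y → pairing y selector ≡ 0#
      triple-vanish y (codeword , weight≡3 , yγ≡1) = begin
        pairing y selector
          ≡⟨ pairing-support y selector ⟩
        sumL (support y) (λ v → coord y v * selector v)
          ≡⟨ sum-cong (support y) (λ v → select-scale (coord y v) _ _) ⟩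
        sumL (support y) (λ v → select (coord y v * dot C₂ v) (coord y v * dot C₁ v))
          ≡⟨ three-point-select (support y) γ∈support weight≡3 _ _ (on-support C₂) (on-support C₁)
               (at-γ C₂ C₂γ≡0) (at-γ C₁ C₁γ≡0) ⟩
        0#
          ∎
        where
        on-support : ∀ C → sumL (support y) (λ v → coord y v * dot C v) ≡ 0#
        on-support C = trans (sym (pairing-support y (dot C))) (codeword-orthogonal C y codeword)
        at-γ : ∀ C → dot C (proj₁ γ) ≡ 0# → coord y (proj₁ γ) * dot C (proj₁ γ) ≡ 0#
        at-γ C Cγ≡0 = trans (cong (coord y (proj₁ γ) *_) Cγ≡0) (zeroʳ _)
        γ∈support : proj₁ γ ∈ support y
        γ∈support = ∈-filter⁺ _ (∈-allVec m (proj₁ γ))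
          (λ yγ≡0 → 0≢1 (trans (sym yγ≡0) (trans (ext-at (isNorm (proj₁ γ)) _ (proj₂ γ)) yγ≡1)))

      coset-value : ∀ x → Coset γ x → pairing x selector ≡ dot (proj₁ γ) (unitImages selector)
      coset-value x x∈C = begin
        pairing x selector
          ≡⟨ pairing-coset selector (λ _ → pairing-span selector triple-vanish) x∈C ⟩
        pairing (λ α → bar (proj₁ γ) α + - e γ α) selector
          ≡⟨ pairing-+ (bar (proj₁ γ)) (λ α → - e γ α) selector ⟩
        pairing (bar (proj₁ γ)) selector + pairing (λ α → - e γ α) selector
          ≡⟨ cong₂ _+_ (pairing-bar m (proj₁ γ) selector) (pairing-neg (e γ) selector) ⟩
        dot (proj₁ γ) (unitImages selector) + - pairing (e γ) selector
          ≡⟨ cong (λ t → dot (proj₁ γ) (unitImages selector) + - t)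
               (pairing-unit γ selector (select-null _ C₁γ≡0)) ⟩
        dot (proj₁ γ) (unitImages selector) + - 0#
          ≡⟨ trans (cong (dot (proj₁ γ) (unitImages selector) +_) -0#≈0#) (+-identityʳ _) ⟩
        dot (proj₁ γ) (unitImages selector)
          ∎

  cosets-disjoint : ∀ {m} (δ′ κ′ : Vec F m) (nδ : T (isNorm (1# ∷ δ′))) (nκ : T (isNorm (1# ∷ κ′))) →
    3 ≤ dist δ′ κ′ → Disjoint (Coset (1# ∷ δ′ , nδ)) (Coset (1# ∷ κ′ , nκ))
  cosets-disjoint δ′ κ′ nδ nκ far x x∈Cδ x∈Cκ with functional-pair δ′ κ′ far
  ... | c₁ , c₂ , c₁-blind , c₂-blind , separates = separates (begin
    gap (selection c₂ c₁) δ′ κ′   ≡⟨ sym (gap-same-head (select (- dot c₂ δ′) (- dot c₁ δ′)) (selection c₂ c₁) 1# δ′ κ′) ⟩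
    gap (selection C₂ C₁) δ κ     ≡⟨ cong (λ Z → gap Z δ κ) (sym selector-images) ⟩
    gap Z δ κ                     ≡⟨ cong (_− dot Z κ) values-agree ⟩
    dot Z κ − dot Z κ             ≡⟨ -‿inverseʳ (dot Z κ) ⟩
    0#                            ∎)
    where
    δ = 1# ∷ δ′
    κ = 1# ∷ κ′
    C₁ = lift δ′ c₁
    C₂ = lift δ′ c₂
    open TestFunction C₁ C₂
    Z = unitImages selector
    at-δ : ∀ C → dot (lift δ′ C) δ ≡ 0#
    at-δ C = lift-annihilates δ′ δ′ C (-‿inverseʳ _)
    values-agree : dot Z δ ≡ dot Z κ
    values-agree = begin
      dot Z δ             ≡⟨ dot-comm Z δ ⟩
      dot δ Z             ≡⟨ sym (coset-value (δ , nδ) (at-δ c₁) (at-δ c₂) x x∈Cδ) ⟩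
      pairing x selector  ≡⟨ coset-value (κ , nκ) (lift-annihilates δ′ κ′ c₁ c₁-blind)
                                (lift-annihilates δ′ κ′ c₂ c₂-blind) x x∈Cκ ⟩
      dot κ Z             ≡⟨ dot-comm κ Z ⟩
      dot Z κ             ∎

proposition1 : {q : ℕ} (𝔽 : FiniteField q) (m : ℕ) → 2 ≤ m →
    (δ κ : HammingDefs.𝔄 𝔽 m) →
    HammingDefs.FirstIs1 𝔽 (proj₁ δ) → HammingDefs.FirstIs1 𝔽 (proj₁ κ) →
    3 ≤ HammingDefs.dist 𝔽 (proj₁ δ) (proj₁ κ) →
    HammingDefs.Disjoint 𝔽 (HammingDefs.Coset 𝔽 δ) (HammingDefs.Coset 𝔽 κ)
proposition1 𝔽 zero    _ ([] , _) _ () _ _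
proposition1 𝔽 (suc m) _ (_ ∷ δ′ , nδ) (_ ∷ κ′ , nκ) refl refl far =
  cosets-disjoint δ′ κ′ nδ nκ (subst (3 ≤_) (dist-same-head _ δ′ κ′) far)
  where open Development 𝔽
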